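{- Let $k\ge 2$ and let $\mathcal{H}$ be a $k$-uniform threshold hypergraph given by a binary sequence, with short sequence $C(a_1,\dots,a_r)_k$ and adjacency matrix $A(\mathcal{H})=(a_{i,j})$. If $v_i$ and $v_j$ belong to the same block, then $a_{s,i}=a_{s,j}$ for all $s\ne i,j$.
   Context: Let $k\ge 2$ and $n$ be positive integers and let $(b_1,\dots,b_n)_k$ be a binary sequence ($b_i\in\{0,1\}$) with $b_1=\dots=b_{k-1}=0$. The $k$-uniform threshold hypergraph $\mathcal{H}=(V,E)$ given by this sequence has vertex set $V=\{v_1,\dots,v_n\}$, and a set $e$ is an edge if and only if $e$ is a $k$-element subset of $V$ and $b_j=1$, where $j=\max\{i: v_i\in e\}$. The adjacency matrix has entries $a_{i,j}=|\{e\in E: v_i,v_j\in e\}|$ for $i\neq j$. Short sequence: if $b_k=0$, $(a_1,\dots,a_r)$ are the lengths of the successive maximal runs of equal consecutive entries of $(b_1,\dots,b_n)$; if $b_k=1$, $a_1$ is the total length of the first two runs (the initial $k-1$ zeros together with the following run of ones) and $a_2,\dots,a_r$ are the lengths of the subsequent maximal runs. Vertices $v_i,v_j$ belong to the same block if there is $t$ with $a_1+\dots+a_{t-1}<i,j\le a_1+\dots+a_t$. -}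

module Defs where

open import Data.Nat using (ℕ; zero; suc; _+_; _≤_; _<_; _≡ᵇ_)
open import Data.Bool using (Bool; true; false; _∧_; if_then_else_; _≟_)
open import Data.Fin using (Fin; toℕ)
open import Data.Fin.Subset using (Subset; ∣_∣)
open import Data.Vec using (Vec; []; _∷_; lookup; toList)
open import Data.List as List using (List; []; _∷_; length; filter; take)
open import Data.Nat.ListAction using (sum)
open import Data.Maybe using (Maybe; just; nothing)
open import Data.Product using (∃-syntax; _×_)
open import Relation.Nullary using (does)
open import Relation.Unary using (Decidable)
open import Relation.Binary.PropositionalEquality using (_≡_)

-- All subsets of Fin n (a subset is a Vec Bool n; position i ↦ vertex v_{i+1}).
allSubsets : (n : ℕ) → List (Subset n)
allSubsets zero = [] ∷ []
allSubsets (suc n) = List.map (true ∷_) (allSubsets n) List.++ List.map (false ∷_) (allSubsets n)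

top : ∀ {n} → Subset n → Maybe (Fin n)
top [] = nothing
top (x ∷ xs) with top xs
... | just j = just (Fin.suc j)
... | nothing = if x then just Fin.zero else nothing

isEdge : ∀ {n} → ℕ → Vec Bool n → Subset n → Bool
isEdge k b e with top e
... | just j = (∣ e ∣ ≡ᵇ k) ∧ lookup b j
... | nothing = false

adj : ∀ {n} → ℕ → Vec Bool n → Fin n → Fin n → ℕ
adj {n} k b i j =
  length (filter (λ e → isEdge k b e ∧ lookup e i ∧ lookup e j ≟ true) (allSubsets n))

runsFrom : Bool → ℕ → List Bool → List ℕ
runsFrom c m [] = m ∷ []
runsFrom c m (y ∷ ys) = if does (y ≟ c) then runsFrom c (suc m) ys else m ∷ runsFrom y 1 ys

runs : List Bool → List ℕ
runs [] = []
runs (x ∷ xs) = runsFrom x 1 xs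

-- b_k (1-indexed), read as false if k > n
entry : List Bool → ℕ → Bool
entry [] _ = false
entry (x ∷ xs) zero = x
entry (x ∷ xs) (suc m) = entry xs m

bk : ∀ {n} → ℕ → Vec Bool n → Bool
bk zero b = false
bk (suc k) b = entry (toList b) k

mergeFirstTwo : List ℕ → List ℕ
mergeFirstTwo (a ∷ a' ∷ as) = (a + a') ∷ as
mergeFirstTwo as = as

shortSeq : ∀ {n} → ℕ → Vec Bool n → List ℕ
shortSeq k b = if bk k b then mergeFirstTwo (runs (toList b)) else runs (toList b)

-- v_i, v_j in the same block: ∃ t with a_1+..+a_{t-1} < i,j ≤ a_1+..+a_t
-- (here with 0-based Fin indices: a_1+..+a_{t-1} ≤ i,j < a_1+..+a_t, t counted from 0)
SameBlock : ∀ {n} → ℕ → Vec Bool n → Fin n → Fin n → Set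
SameBlock k b i j =
  ∃[ t ] ( (sum (take t as) ≤ toℕ i × toℕ i < sum (take (suc t) as))
         × (sum (take t as) ≤ toℕ j × toℕ j < sum (take (suc t) as)) )
  where as = shortSeq k b

-- Let i < j lie in one block and let τ swap the coordinates i and j of subsets of V. As τ permutes
-- the subsets, adj s i also counts the e such that τe is an edge through v_s and v_i, i.e. such
-- that τe is an edge and e contains v_s and v_j; so it suffices that τ maps edges to edges. The
-- top vertex of e is fixed by τ unless it lies in [i, j]; then the tops of e and τe both lie in
-- [i, j], at positions ≥ k - 1 when |e| = k, where b is constant: i and j share a block, and when
-- b_k = 1 the merged first block is constant from position k - 1 on because b_1 = 0 ≠ b_k.
-- Invariance of the subset list and of cardinality under all transpositions reduces, by lifting
-- and conjugation, to the swap of the first two coordinates.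

module Submission where

open import Level using (Level)
open import Algebra.Bundles using (CommutativeMonoid)
import Algebra.Properties.CommutativeSemigroup as CommutativeSemigroupProperties
open import Data.Nat using (ℕ; zero; suc; _+_; _∸_; _≤_; _<_; s≤s; z≤n; _≡ᵇ_)
open import Data.Nat.Properties
  using ( ≤-refl; ≤-trans; <-trans; ≤-<-trans; n≤1+n; ≡ᵇ⇒≡; _≤?_; ≰⇒>
        ; +-identityʳ; +-assoc; +-cancelˡ-≤; +-cancelˡ-<; m+n≤o⇒m≤o; m≤n⇒∃[o]m+o≡n )
open import Data.Bool using (Bool; true; false; _∧_; T)
import Data.Bool as Bool
open import Data.Unit using (tt)
open import Data.Empty using (⊥-elim)
open import Data.Maybe using (just; nothing)
open import Data.Maybe.Properties using (just-injective)
open import Data.Product using (∃-syntax; _×_; _,_; proj₁; proj₂)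
open import Data.Sum using (_⊎_; inj₁; inj₂)
open import Data.Fin using (Fin; zero; suc; toℕ; lift)
open import Data.Fin.Patterns using (0F; 1F)
open import Data.Fin.Properties using (_≟_; <-cmp; <⇒≢)
open import Data.Fin.Subset using (Subset; ∣_∣)
open import Data.Fin.Permutation.Components using (transpose; transpose-inverse)
open import Data.Vec using (Vec; []; _∷_; lookup; tabulate; toList)
open import Data.Vec.Properties using (lookup∘tabulate; tabulate∘lookup; tabulate-cong)
open import Data.List using (List; []; _∷_; map; length; filter; take; replicate; _++_)
open import Data.List.Properties using (map-++; map-cong; map-∘; map-id)
open import Data.Nat.ListAction using (sum)
open import Data.List.Relation.Binary.Permutation.Propositional
  using (_↭_; ↭-trans; ↭-reflexive; module PermutationReasoning)
import Data.List.Relation.Binary.Permutation.Propositional.Properties as ↭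
open import Function using (id; _∘_)
open import Relation.Nullary using (Dec; does; yes; no)
open import Relation.Nullary.Decidable using (dec-true; dec-false)
open import Relation.Binary.Definitions using (tri<; tri≈; tri>)
open import Relation.Binary.PropositionalEquality
open import Defs

private variable
  a : Level
  A B : Set a
  n k : ℕ

transpose-matchˡ : (i j : Fin n) → transpose i j i ≡ j
transpose-matchˡ i j rewrite dec-true (i ≟ i) refl = refl

transpose-matchʳ : (i j : Fin n) → transpose i j j ≡ i
transpose-matchʳ i j with j ≟ i
... | yes refl = refl
... | no _ rewrite dec-true (j ≟ j) refl = refl

transpose-other : {i j x : Fin n} → x ≢ i → x ≢ j → transpose i j x ≡ x
transpose-other {i = i} {j} {x} x≢i x≢j rewrite dec-false (x ≟ i) x≢i | dec-false (x ≟ j) x≢j = refl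

transpose-sym : (i j : Fin n) → transpose i j ≗ transpose j i
transpose-sym i j x = by-cases (x ≟ i) (x ≟ j)
  where
  by-cases : Dec (x ≡ i) → Dec (x ≡ j) → transpose i j x ≡ transpose j i x
  by-cases (yes refl) _ = trans (transpose-matchˡ x j) (sym (transpose-matchʳ j x))
  by-cases (no _) (yes refl) = trans (transpose-matchʳ i x) (sym (transpose-matchˡ x i))
  by-cases (no x≢i) (no x≢j) = trans (transpose-other x≢i x≢j) (sym (transpose-other x≢j x≢i))

transpose-involutive : (i j : Fin n) → transpose i j ∘ transpose i j ≗ id
transpose-involutive i j x = trans (cong (transpose i j) (transpose-sym i j x)) (transpose-inverse i j)

transpose-self : (i : Fin n) → transpose i i ≗ id
transpose-self i x = by-cases (x ≟ i)
  where
  by-cases : Dec (x ≡ i) → transpose i i x ≡ x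
  by-cases (yes refl) = transpose-matchˡ x x
  by-cases (no x≢i) = transpose-other x≢i x≢i

transpose-suc : (i j : Fin n) → transpose (suc i) (suc j) ≗ lift 1 (transpose i j)
transpose-suc i j zero = refl
transpose-suc i j (suc x) with does (x ≟ i)
... | true = refl
... | false with does (x ≟ j)
...   | true = refl
...   | false = refl

transpose-conjugate : (q : Fin n) →
  transpose 0F (suc (suc q)) ≗ transpose 0F 1F ∘ lift 1 (transpose 0F (suc q)) ∘ transpose 0F 1F
transpose-conjugate q zero = refl
transpose-conjugate q (suc zero) = refl
transpose-conjugate q (suc (suc x)) with does (x ≟ q)
... | true = refl
... | false = refl

module _ {ℓ : Level} (P : ∀ {n} → (Fin n → Fin n) → Set ℓ)
  (P-resp : ∀ {n} {π ρ : Fin n → Fin n} → π ≗ ρ → P ρ → P π)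
  (P-∘ : ∀ {n} {π ρ : Fin n → Fin n} → P π → P ρ → P (π ∘ ρ))
  (P-id : ∀ {n} → P {n} id)
  (P-swap : ∀ {n} → P {suc (suc n)} (transpose 0F 1F))
  (P-lift : ∀ {n} {π : Fin n → Fin n} → P π → P (lift 1 π))
  where

  transposition-induction : (i j : Fin n) → P (transpose i j)
  transposition-induction-0 : (j : Fin (suc n)) → P (transpose 0F j)

  transposition-induction zero j = transposition-induction-0 j
  transposition-induction (suc i) zero = P-resp (transpose-sym (suc i) 0F) (transposition-induction-0 (suc i))
  transposition-induction (suc i) (suc j) = P-resp (transpose-suc i j) (P-lift (transposition-induction i j))

  transposition-induction-0 zero = P-resp (transpose-self 0F) P-id
  transposition-induction-0 (suc zero) = P-swap
  transposition-induction-0 {suc n} (suc (suc q)) =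
    P-resp (transpose-conjugate q) (P-∘ P-swap (P-∘ (P-lift (transposition-induction-0 (suc q))) P-swap))

reindex : (Fin n → Fin n) → Vec A n → Vec A n
reindex π e = tabulate (lookup e ∘ π)

lookup-reindex : (π : Fin n → Fin n) (e : Vec A n) (x : Fin n) → lookup (reindex π e) x ≡ lookup e (π x)
lookup-reindex π e = lookup∘tabulate (lookup e ∘ π)

reindex-cong : {π ρ : Fin n → Fin n} → π ≗ ρ → (e : Vec A n) → reindex π e ≡ reindex ρ e
reindex-cong π≗ρ e = tabulate-cong (cong (lookup e) ∘ π≗ρ)

reindex-id : (e : Vec A n) → reindex id e ≡ e
reindex-id = tabulate∘lookup

reindex-∘ : (π ρ : Fin n → Fin n) (e : Vec A n) → reindex (π ∘ ρ) e ≡ reindex ρ (reindex π e)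
reindex-∘ π ρ e = sym (tabulate-cong (lookup-reindex π e ∘ ρ))

reindex-swap : (x y : A) (e : Vec A n) → reindex (transpose 0F 1F) (x ∷ y ∷ e) ≡ y ∷ x ∷ e
reindex-swap x y e = cong (λ e′ → y ∷ x ∷ e′) (tabulate∘lookup e)

reindex-transpose-involutive : (i j : Fin n) (e : Vec A n)
  → reindex (transpose i j) (reindex (transpose i j) e) ≡ e
reindex-transpose-involutive i j e = begin
  reindex (transpose i j) (reindex (transpose i j) e) ≡⟨ reindex-∘ (transpose i j) (transpose i j) e ⟨
  reindex (transpose i j ∘ transpose i j) e            ≡⟨ reindex-cong (transpose-involutive i j) e ⟩
  reindex id e                                         ≡⟨ reindex-id e ⟩
  e                                                    ∎
  where open ≡-Reasoning

∣reindex-transpose∣ : (i j : Fin n) (e : Subset n) → ∣ reindex (transpose i j) e ∣ ≡ ∣ e ∣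
∣reindex-transpose∣ = transposition-induction P P-resp P-∘ P-id P-swap P-lift
  where
  P : (Fin n → Fin n) → Set
  P π = ∀ e → ∣ reindex π e ∣ ≡ ∣ e ∣
  P-resp : {π ρ : Fin n → Fin n} → π ≗ ρ → P ρ → P π
  P-resp π≗ρ Pρ e = trans (cong ∣_∣ (reindex-cong π≗ρ e)) (Pρ e)
  P-∘ : {π ρ : Fin n → Fin n} → P π → P ρ → P (π ∘ ρ)
  P-∘ {π = π} {ρ} Pπ Pρ e = trans (cong ∣_∣ (reindex-∘ π ρ e)) (trans (Pρ (reindex π e)) (Pπ e))
  P-id : P {n} id
  P-id e = cong ∣_∣ (reindex-id e)
  P-swap : P {suc (suc n)} (transpose 0F 1F)
  P-swap (x ∷ y ∷ e) = trans (cong ∣_∣ (reindex-swap x y e)) (∣∣-swap x y)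
    where
    ∣∣-swap : (x y : Bool) → ∣ y ∷ x ∷ e ∣ ≡ ∣ x ∷ y ∷ e ∣
    ∣∣-swap true true = refl
    ∣∣-swap true false = refl
    ∣∣-swap false true = refl
    ∣∣-swap false false = refl
  P-lift : {π : Fin n → Fin n} → P π → P (lift 1 π)
  P-lift Pπ (true ∷ e) = cong suc (Pπ e)
  P-lift Pπ (false ∷ e) = Pπ e

map-reindex-transpose-allSubsets-↭ : (i j : Fin n) → map (reindex (transpose i j)) (allSubsets n) ↭ allSubsets n
map-reindex-transpose-allSubsets-↭ = transposition-induction P P-resp P-∘ P-id P-swap P-lift
  where
  open PermutationReasoning
  P : (Fin n → Fin n) → Set
  P {n} π = map (reindex π) (allSubsets n) ↭ allSubsets n
  P-resp : {π ρ : Fin n → Fin n} → π ≗ ρ → P ρ → P π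
  P-resp π≗ρ Pρ = ↭-trans (↭-reflexive (map-cong (reindex-cong π≗ρ) _)) Pρ
  P-∘ : {π ρ : Fin n → Fin n} → P π → P ρ → P (π ∘ ρ)
  P-∘ {n} {π} {ρ} Pπ Pρ = begin
    map (reindex (π ∘ ρ)) S                ≡⟨ map-cong (reindex-∘ π ρ) S ⟩
    map (reindex ρ ∘ reindex π) S          ≡⟨ map-∘ S ⟩
    map (reindex ρ) (map (reindex π) S)    ↭⟨ ↭.map⁺ (reindex ρ) Pπ ⟩
    map (reindex ρ) S                      ↭⟨ Pρ ⟩
    S                                      ∎
    where S = allSubsets n
  P-id : P {n} id
  P-id {n} = ↭-reflexive (trans (map-cong reindex-id (allSubsets n)) (map-id (allSubsets n)))
  P-lift : {π : Fin n → Fin n} → P π → P (lift 1 π)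
  P-lift {n} {π} Pπ = begin
    map (reindex (lift 1 π)) (map (true ∷_) S ++ map (false ∷_) S)
      ≡⟨ map-++ (reindex (lift 1 π)) (map (true ∷_) S) (map (false ∷_) S) ⟩
    map (reindex (lift 1 π)) (map (true ∷_) S) ++ map (reindex (lift 1 π)) (map (false ∷_) S)
      ≡⟨ cong₂ _++_ (lift-prefix true) (lift-prefix false) ⟩
    map (true ∷_) (map (reindex π) S) ++ map (false ∷_) (map (reindex π) S)
      ↭⟨ ↭.++⁺ (↭.map⁺ (true ∷_) Pπ) (↭.map⁺ (false ∷_) Pπ) ⟩
    map (true ∷_) S ++ map (false ∷_) S
      ∎
    where
    S = allSubsets n
    lift-prefix : (x : Bool) → map (reindex (lift 1 π)) (map (x ∷_) S) ≡ map (x ∷_) (map (reindex π) S)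
    lift-prefix x = trans (sym (map-∘ S)) (map-∘ S)
  P-swap : P {suc (suc n)} (transpose 0F 1F)
  P-swap {n} = begin
    map sw S₂                                    ≡⟨ cong (map sw) split ⟩
    map sw ((TT ++ TF) ++ (FT ++ FF))            ≡⟨ map-++ sw (TT ++ TF) (FT ++ FF) ⟩
    map sw (TT ++ TF) ++ map sw (FT ++ FF)       ≡⟨ cong₂ _++_ (map-++ sw TT TF) (map-++ sw FT FF) ⟩
    (map sw TT ++ map sw TF) ++ (map sw FT ++ map sw FF)
      ≡⟨ cong₂ _++_ (cong₂ _++_ (swap-prefix true true) (swap-prefix true false))
                    (cong₂ _++_ (swap-prefix false true) (swap-prefix false false)) ⟩
    (TT ++ FT) ++ (TF ++ FF)                     ↭⟨ interchange TT FT TF FF ⟩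
    (TT ++ TF) ++ (FT ++ FF)                     ≡⟨ split ⟨
    S₂                                           ∎
    where
    open CommutativeSemigroupProperties (CommutativeMonoid.commutativeSemigroup ↭.++-commutativeMonoid)
      using (interchange)
    S = allSubsets n
    S₂ = allSubsets (suc (suc n))
    sw = reindex (transpose 0F 1F)
    prefixed : Bool → Bool → List (Subset (suc (suc n)))
    prefixed x y = map (λ e → x ∷ y ∷ e) S
    TT = prefixed true true
    TF = prefixed true false
    FT = prefixed false true
    FF = prefixed false false
    split : S₂ ≡ (TT ++ TF) ++ (FT ++ FF)
    split = cong₂ _++_ (half true) (half false)
      where
      unfold : (x y : Bool) → map (x ∷_) (map (y ∷_) S) ≡ prefixed x y
      unfold x y = sym (map-∘ S)
      half : (x : Bool) → map (x ∷_) (allSubsets (suc n)) ≡ prefixed x true ++ prefixed x false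
      half x = trans (map-++ (x ∷_) (map (true ∷_) S) (map (false ∷_) S))
                     (cong₂ _++_ (unfold x true) (unfold x false))
    swap-prefix : (x y : Bool) → map sw (prefixed x y) ≡ prefixed y x
    swap-prefix x y = trans (sym (map-∘ S)) (map-cong (reindex-swap x y) S)

count : (A → Bool) → List A → ℕ
count p xs = length (filter (λ x → p x Bool.≟ true) xs)

count-↭ : (p : A → Bool) {xs ys : List A} → xs ↭ ys → count p xs ≡ count p ys
count-↭ p xs↭ys = ↭.↭-length (↭.filter-↭ (λ x → p x Bool.≟ true) xs↭ys)

count-map : {p : B → Bool} {q : A → Bool} (f : A → B) → (∀ x → p (f x) ≡ q x)
  → (xs : List A) → count p (map f xs) ≡ count q xs
count-map f pf≗q [] = refl
count-map {q = q} f pf≗q (x ∷ xs) rewrite pf≗q x with q x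
... | true = cong suc (count-map f pf≗q xs)
... | false = count-map f pf≗q xs

IsTop : Subset n → Fin n → Set
IsTop e m = lookup e m ≡ true × (∀ x → toℕ m < toℕ x → lookup e x ≡ false)

top-nothing⇒empty : (e : Subset n) → top e ≡ nothing → ∀ x → lookup e x ≡ false
top-nothing⇒empty (c ∷ e) te x with top e in te′
top-nothing⇒empty (true ∷ e) () x | nothing
top-nothing⇒empty (false ∷ e) te zero | nothing = refl
top-nothing⇒empty (false ∷ e) te (suc x) | nothing = top-nothing⇒empty e te′ x

top-just⇒IsTop : (e : Subset n) {m : Fin n} → top e ≡ just m → IsTop e m
top-just⇒IsTop (c ∷ e) te with top e in te′
top-just⇒IsTop (c ∷ e) refl | just m =
  proj₁ (top-just⇒IsTop e te′) , λ { (suc x) (s≤s m<x) → proj₂ (top-just⇒IsTop e te′) x m<x }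
top-just⇒IsTop (true ∷ e) refl | nothing = refl , λ { (suc x) _ → top-nothing⇒empty e te′ x }

IsTop⇒top-just : (e : Subset n) {m : Fin n} → IsTop e m → top e ≡ just m
IsTop⇒top-just (c ∷ e) {zero} (c≡true , above) with top e in te
... | just m with () ← trans (sym (proj₁ (top-just⇒IsTop e te))) (above (suc m) (s≤s z≤n))
... | nothing rewrite c≡true = refl
IsTop⇒top-just (c ∷ e) {suc m} (em≡true , above)
  rewrite IsTop⇒top-just e (em≡true , λ x m<x → above (suc x) (s≤s m<x)) = refl

IsTop-unique : (e : Subset n) {m m′ : Fin n} → IsTop e m → IsTop e m′ → m ≡ m′
IsTop-unique e top₁ top₂ = just-injective (trans (sym (IsTop⇒top-just e top₁)) (IsTop⇒top-just e top₂))

∣∣≡0 : (e : Subset n) → (∀ x → lookup e x ≡ false) → ∣ e ∣ ≡ 0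
∣∣≡0 [] _ = refl
∣∣≡0 (c ∷ e) empty rewrite empty zero = ∣∣≡0 e (empty ∘ suc)

∣∣≤1+top : (e : Subset n) (m : Fin n) → (∀ x → toℕ m < toℕ x → lookup e x ≡ false)
  → ∣ e ∣ ≤ suc (toℕ m)
∣∣≤1+top (c ∷ e) zero above rewrite ∣∣≡0 e (λ x → above (suc x) (s≤s z≤n)) with c
... | true = ≤-refl
... | false = z≤n
∣∣≤1+top (c ∷ e) (suc m) above with c | ∣∣≤1+top e m (λ x m<x → above (suc x) (s≤s m<x))
... | true | ∣e∣≤1+m = s≤s ∣e∣≤1+m
... | false | ∣e∣≤1+m = ≤-trans ∣e∣≤1+m (n≤1+n _)

IsTop-reindex : (π : Fin n → Fin n) (e : Subset n) {m : Fin n}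
  → π m ≡ m → (∀ x → toℕ m < toℕ x → toℕ m < toℕ (π x))
  → IsTop e m → IsTop (reindex π e) m
IsTop-reindex π e {m} πm≡m π-above (em≡true , above) =
  trans (lookup-reindex π e m) (trans (cong (lookup e) πm≡m) em≡true) ,
  λ x m<x → trans (lookup-reindex π e x) (above (π x) (π-above x m<x))

transpose-below : {i j m : Fin n} → toℕ m < toℕ i → toℕ m < toℕ j
  → ∀ x → toℕ m < toℕ x → toℕ m < toℕ (transpose i j x)
transpose-below {i = i} {j} {m} m<i m<j x m<x = by-cases (x ≟ i) (x ≟ j)
  where
  by-cases : Dec (x ≡ i) → Dec (x ≡ j) → toℕ m < toℕ (transpose i j x)
  by-cases (yes refl) _ = subst (λ y → toℕ m < toℕ y) (sym (transpose-matchˡ x j)) m<j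
  by-cases (no _) (yes refl) = subst (λ y → toℕ m < toℕ y) (sym (transpose-matchʳ i x)) m<i
  by-cases (no x≢i) (no x≢j) = subst (λ y → toℕ m < toℕ y) (sym (transpose-other x≢i x≢j)) m<x

transpose-above : {i j x : Fin n} → toℕ i < toℕ x → toℕ j < toℕ x → transpose i j x ≡ x
transpose-above i<x j<x = transpose-other (<⇒≢ i<x ∘ sym) (<⇒≢ j<x ∘ sym)

Between : Fin n → Fin n → Fin n → Set
Between i j m = toℕ i ≤ toℕ m × toℕ m ≤ toℕ j

Outside : Fin n → Fin n → Fin n → Set
Outside i j m = toℕ m < toℕ i ⊎ toℕ j < toℕ m

outside-or-between : (i j m : Fin n) → Outside i j m ⊎ Between i j m
outside-or-between i j m with toℕ i ≤? toℕ m | toℕ m ≤? toℕ j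
... | no i≰m | _ = inj₁ (inj₁ (≰⇒> i≰m))
... | yes _ | no m≰j = inj₁ (inj₂ (≰⇒> m≰j))
... | yes i≤m | yes m≤j = inj₂ (i≤m , m≤j)

IsTop-reindex-transpose : {i j m : Fin n} (e : Subset n) → toℕ i < toℕ j → Outside i j m
  → IsTop e m → IsTop (reindex (transpose i j) e) m
IsTop-reindex-transpose {i = i} {j} e i<j (inj₁ m<i) =
  IsTop-reindex (transpose i j) e (transpose-other (<⇒≢ m<i) (<⇒≢ (<-trans m<i i<j)))
    (transpose-below m<i (<-trans m<i i<j))
IsTop-reindex-transpose {i = i} {j} {m} e i<j (inj₂ j<m) =
  IsTop-reindex (transpose i j) e (transpose-above (<-trans i<j j<m) j<m)
    λ x m<x → subst (λ y → toℕ m < toℕ y)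
      (sym (transpose-above (<-trans (<-trans i<j j<m) m<x) (<-trans j<m m<x))) m<x

transpose-top : {i j m m′ : Fin n} (e : Subset n) → toℕ i < toℕ j
  → IsTop e m → IsTop (reindex (transpose i j) e) m′ → m′ ≡ m ⊎ (Between i j m × Between i j m′)
transpose-top {i = i} {j} {m} {m′} e i<j top top′ with outside-or-between i j m | outside-or-between i j m′
... | inj₁ m-out | _ = inj₁ (IsTop-unique e′ top′ (IsTop-reindex-transpose e i<j m-out top))
  where e′ = reindex (transpose i j) e
... | _ | inj₁ m′-out = inj₁ (IsTop-unique e top″ top)
  where
  e′ = reindex (transpose i j) e
  top″ : IsTop e m′
  top″ = subst (λ e″ → IsTop e″ m′) (reindex-transpose-involutive i j e) (IsTop-reindex-transpose e′ i<j m′-out top′)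
... | inj₂ m-in | inj₂ m′-in = inj₂ (m-in , m′-in)

∧-congˡ-T : {c x y : Bool} → (T c → x ≡ y) → c ∧ x ≡ c ∧ y
∧-congˡ-T {false} _ = refl
∧-congˡ-T {true} x≡y = x≡y tt

-- k ≤ suc (toℕ m) says that m can be the top vertex of a k-set.
ConstantOnTops : ℕ → Vec Bool n → Fin n → Fin n → Set
ConstantOnTops {n} k b i j = ∀ {m m′ : Fin n} → Between i j m → Between i j m′
  → k ≤ suc (toℕ m) → k ≤ suc (toℕ m′) → lookup b m ≡ lookup b m′

isEdge-reindex-transpose : (b : Vec Bool n) {i j : Fin n} → toℕ i < toℕ j → ConstantOnTops k b i j
  → (e : Subset n) → isEdge k b (reindex (transpose i j) e) ≡ isEdge k b e
isEdge-reindex-transpose {k = k} b {i} {j} i<j constant e with top e in te | top (reindex (transpose i j) e) in te′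
... | nothing | nothing = refl
-- e and τe are empty together: an element m of e gives the element τ m of τe, and conversely.
... | just m | nothing with () ← trans (sym (proj₁ (top-just⇒IsTop e te)))
      (trans (cong (lookup e) (sym (transpose-involutive i j m)))
        (trans (sym (lookup-reindex (transpose i j) e (transpose i j m)))
          (top-nothing⇒empty (reindex (transpose i j) e) te′ (transpose i j m))))
... | nothing | just m′ with () ← trans (sym (proj₁ (top-just⇒IsTop (reindex (transpose i j) e) te′)))
      (trans (lookup-reindex (transpose i j) e m′) (top-nothing⇒empty e te _))
... | just m | just m′ = begin
  (∣ e′ ∣ ≡ᵇ k) ∧ lookup b m′  ≡⟨ cong (λ c → (c ≡ᵇ k) ∧ lookup b m′) (∣reindex-transpose∣ i j e) ⟩
  (∣ e ∣ ≡ᵇ k) ∧ lookup b m′   ≡⟨ ∧-congˡ-T (top-bits-agree ∘ ≡ᵇ⇒≡ ∣ e ∣ k) ⟩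
  (∣ e ∣ ≡ᵇ k) ∧ lookup b m    ∎
  where
  open ≡-Reasoning
  e′ = reindex (transpose i j) e
  m-top : IsTop e m
  m-top = top-just⇒IsTop e te
  m′-top : IsTop e′ m′
  m′-top = top-just⇒IsTop e′ te′
  top-bits-agree : ∣ e ∣ ≡ k → lookup b m′ ≡ lookup b m
  top-bits-agree ∣e∣≡k with transpose-top e i<j m-top m′-top
  ... | inj₁ m′≡m = cong (lookup b) m′≡m
  ... | inj₂ (m-in , m′-in) = constant m′-in m-in
    (subst (_≤ _) (trans (∣reindex-transpose∣ i j e) ∣e∣≡k) (∣∣≤1+top e′ m′ (proj₂ m′-top)))
    (subst (_≤ _) ∣e∣≡k (∣∣≤1+top e m (proj₂ m-top)))

adj-transpose : (b : Vec Bool n) {i j s : Fin n} → toℕ i < toℕ j → ConstantOnTops k b i j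
  → s ≢ i → s ≢ j → adj k b s i ≡ adj k b s j
adj-transpose {n} {k} b {i} {j} {s} i<j constant s≢i s≢j = begin
  count (edgeThrough i) (allSubsets n)
    ≡⟨ count-↭ (edgeThrough i) (map-reindex-transpose-allSubsets-↭ i j) ⟨
  count (edgeThrough i) (map (reindex (transpose i j)) (allSubsets n))
    ≡⟨ count-map (reindex (transpose i j)) swapped (allSubsets n) ⟩
  count (edgeThrough j) (allSubsets n)
    ∎
  where
  open ≡-Reasoning
  edgeThrough : Fin n → Subset n → Bool
  edgeThrough x e = isEdge k b e ∧ lookup e s ∧ lookup e x
  swapped : ∀ e → edgeThrough i (reindex (transpose i j) e) ≡ edgeThrough j e
  swapped e = cong₂ _∧_ (isEdge-reindex-transpose b i<j constant e) (cong₂ _∧_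
    (trans (lookup-reindex (transpose i j) e s) (cong (lookup e) (transpose-other s≢i s≢j)))
    (trans (lookup-reindex (transpose i j) e i) (cong (lookup e) (transpose-matchˡ i j))))

record InBlock (as : List ℕ) (t x : ℕ) : Set where
  constructor inBlock
  field
    lower : sum (take t as) ≤ x
    upper : x < sum (take (suc t) as)

BlockConstant : List ℕ → (ℕ → Bool) → Set
BlockConstant as E = ∀ {t x y} → InBlock as t x → InBlock as t y → E x ≡ E y

InBlock-zero : {a x : ℕ} {as : List ℕ} → InBlock (a ∷ as) 0 x → x < a
InBlock-zero {a} (inBlock _ x<a+0) = subst (_ <_) (+-identityʳ a) x<a+0

InBlock-suc : {a t x : ℕ} {as : List ℕ} → InBlock (a ∷ as) (suc t) x
  → ∃[ d ] (x ≡ a + d × InBlock as t d)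
InBlock-suc {a} (inBlock lo hi) with m≤n⇒∃[o]m+o≡n (m+n≤o⇒m≤o a lo)
... | d , refl = d , refl , inBlock (+-cancelˡ-≤ a _ _ lo) (+-cancelˡ-< a _ _ hi)

entry-replicate-< : {m x : ℕ} (c : Bool) (l : List Bool) → x < m → entry (replicate m c ++ l) x ≡ c
entry-replicate-< {suc m} {zero} c l _ = refl
entry-replicate-< {suc m} {suc x} c l (s≤s x<m) = entry-replicate-< c l x<m

entry-replicate-+ : (m : ℕ) (c : Bool) (l : List Bool) (x : ℕ)
  → entry (replicate m c ++ l) (m + x) ≡ entry l x
entry-replicate-+ zero c l x = refl
entry-replicate-+ (suc m) c l x = entry-replicate-+ m c l x

replicate-snoc : (m : ℕ) (c : Bool) (l : List Bool) → replicate m c ++ c ∷ l ≡ replicate (suc m) c ++ l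
replicate-snoc zero c l = refl
replicate-snoc (suc m) c l = cong (c ∷_) (replicate-snoc m c l)

-- runsFrom c m ys lists the run lengths of replicate m c ++ ys.
runsFrom-blockConstant : (c : Bool) (m : ℕ) (ys : List Bool)
  → BlockConstant (runsFrom c m ys) (entry (replicate m c ++ ys))
runsFrom-blockConstant c m [] {zero} x∈t y∈t =
  trans (entry-replicate-< c [] (InBlock-zero x∈t)) (sym (entry-replicate-< c [] (InBlock-zero y∈t)))
runsFrom-blockConstant c m [] {suc t} x∈t _ with InBlock-suc x∈t
... | _ , _ , inBlock _ ()
runsFrom-blockConstant c m (y₀ ∷ ys) x∈t y∈t with y₀ Bool.≟ c
... | yes refl rewrite replicate-snoc m y₀ ys = runsFrom-blockConstant y₀ (suc m) ys x∈t y∈t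
... | no _ = shifted _ x∈t y∈t
  where
  rest = runsFrom y₀ 1 ys
  shifted : ∀ t {x y} → InBlock (m ∷ rest) t x → InBlock (m ∷ rest) t y
    → entry (replicate m c ++ y₀ ∷ ys) x ≡ entry (replicate m c ++ y₀ ∷ ys) y
  shifted zero x∈t y∈t =
    trans (entry-replicate-< c _ (InBlock-zero x∈t)) (sym (entry-replicate-< c _ (InBlock-zero y∈t)))
  shifted (suc t) x∈t y∈t with InBlock-suc x∈t | InBlock-suc y∈t
  ... | dx , refl , dx∈t | dy , refl , dy∈t = begin
    entry (replicate m c ++ y₀ ∷ ys) (m + dx) ≡⟨ entry-replicate-+ m c (y₀ ∷ ys) dx ⟩
    entry (y₀ ∷ ys) dx                        ≡⟨ runsFrom-blockConstant y₀ 1 ys dx∈t dy∈t ⟩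
    entry (y₀ ∷ ys) dy                        ≡⟨ entry-replicate-+ m c (y₀ ∷ ys) dy ⟨
    entry (replicate m c ++ y₀ ∷ ys) (m + dy) ∎
    where open ≡-Reasoning

runs-blockConstant : (l : List Bool) → BlockConstant (runs l) (entry l)
runs-blockConstant [] (inBlock _ ())
runs-blockConstant (c ∷ l) = runsFrom-blockConstant c 1 l

mergeFirstTwo-blockConstant : (E : ℕ → Bool) {c : ℕ} (rs : List ℕ) → BlockConstant rs E → E 0 ≢ E c
  → ∀ {t x y} → InBlock (mergeFirstTwo rs) t x → InBlock (mergeFirstTwo rs) t y
  → c ≤ x → c ≤ y → E x ≡ E y
mergeFirstTwo-blockConstant E [] constant _ x∈t y∈t _ _ = constant x∈t y∈t
mergeFirstTwo-blockConstant E (a ∷ []) constant _ x∈t y∈t _ _ = constant x∈t y∈t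
mergeFirstTwo-blockConstant E {c} (a ∷ a′ ∷ as) constant E0≢Ec {suc t} x∈t y∈t _ _ =
  constant (regroup x∈t) (regroup y∈t)
  where
  regroup : ∀ {x} → InBlock ((a + a′) ∷ as) (suc t) x → InBlock (a ∷ a′ ∷ as) (suc (suc t)) x
  regroup {x} (inBlock lo hi) = inBlock (subst (_≤ x) (+-assoc a a′ _) lo) (subst (x <_) (+-assoc a a′ _) hi)
mergeFirstTwo-blockConstant E {c} (a ∷ a′ ∷ as) constant E0≢Ec {zero} x∈t y∈t c≤x c≤y =
  constant (second x∈t c≤x) (second y∈t c≤y)
  where
  -- E is constant on the first block of rs but E 0 ≢ E c, so c lies beyond that block.
  a≤c : a ≤ c
  a≤c with a ≤? c
  ... | yes a≤c = a≤c
  ... | no a≰c = ⊥-elim (E0≢Ec (constant {0} (inBlock z≤n (≤-<-trans z≤n c<a+0)) (inBlock z≤n c<a+0)))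
    where
    c<a+0 : c < a + 0
    c<a+0 = subst (c <_) (sym (+-identityʳ a)) (≰⇒> a≰c)
  second : ∀ {x} → InBlock ((a + a′) ∷ as) 0 x → c ≤ x → InBlock (a ∷ a′ ∷ as) 1 x
  second {x} (inBlock _ hi) c≤x =
    inBlock (subst (_≤ x) (sym (+-identityʳ a)) (≤-trans a≤c c≤x)) (subst (x <_) (+-assoc a a′ 0) hi)

entry-toList : (b : Vec Bool n) (x : Fin n) → entry (toList b) (toℕ x) ≡ lookup b x
entry-toList (c ∷ b) zero = refl
entry-toList (c ∷ b) (suc x) = entry-toList b x

LeadingZeros : ℕ → Vec Bool n → Set
LeadingZeros {n} k b = ∀ (i : Fin n) → toℕ i < k ∸ 1 → lookup b i ≡ false

leadingZeros⇒entry-0 : (b : Vec Bool n) → LeadingZeros (suc (suc k)) b → entry (toList b) 0 ≡ false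
leadingZeros⇒entry-0 [] _ = refl
leadingZeros⇒entry-0 (c ∷ b) zeros = zeros zero (s≤s z≤n)

shortSeq-blockConstant : (k : ℕ) (b : Vec Bool n) → 2 ≤ k → LeadingZeros k b
  → ∀ {t x y} → InBlock (shortSeq k b) t x → InBlock (shortSeq k b) t y → k ≤ suc x → k ≤ suc y
  → entry (toList b) x ≡ entry (toList b) y
shortSeq-blockConstant (suc (suc k)) b (s≤s (s≤s z≤n)) zeros x∈t y∈t (s≤s 1+k≤x) (s≤s 1+k≤y)
  with bk (suc (suc k)) b in bk≡
... | false = runs-blockConstant (toList b) x∈t y∈t
... | true = mergeFirstTwo-blockConstant (entry (toList b)) (runs (toList b)) (runs-blockConstant (toList b))
               first≢kth x∈t y∈t 1+k≤x 1+k≤y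
  where
  first≢kth : entry (toList b) 0 ≢ entry (toList b) (suc k)
  first≢kth first≡kth with () ← trans (sym (leadingZeros⇒entry-0 b zeros)) (trans first≡kth bk≡)

sameBlock⇒constantOnTops : (k : ℕ) (b : Vec Bool n) → 2 ≤ k → LeadingZeros k b
  → {i j : Fin n} → SameBlock k b i j → ConstantOnTops k b i j
sameBlock⇒constantOnTops k b 2≤k zeros {i} {j} (t , (i-lo , _) , (_ , j-hi)) {m} {m′} m-in m′-in k≤1+m k≤1+m′ =
  begin
  lookup b m                ≡⟨ entry-toList b m ⟨
  entry (toList b) (toℕ m)  ≡⟨ shortSeq-blockConstant k b 2≤k zeros (in-block m-in) (in-block m′-in) k≤1+m k≤1+m′ ⟩
  entry (toList b) (toℕ m′) ≡⟨ entry-toList b m′ ⟩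
  lookup b m′               ∎
  where
  open ≡-Reasoning
  in-block : ∀ {x} → Between i j x → InBlock (shortSeq k b) t (toℕ x)
  in-block (i≤x , x≤j) = inBlock (≤-trans i-lo i≤x) (≤-<-trans x≤j j-hi)

corollary1 : (k n : ℕ) → 2 ≤ k → (b : Vec Bool n)
    → (∀ (i : Fin n) → toℕ i < k ∸ 1 → lookup b i ≡ false)
    → (i j : Fin n) → SameBlock k b i j
    → (s : Fin n) → s ≢ i → s ≢ j → adj k b s i ≡ adj k b s j
corollary1 k n 2≤k b zeros i j same-block s s≢i s≢j with <-cmp i j
... | tri< i<j _ _ = adj-transpose b i<j (sameBlock⇒constantOnTops k b 2≤k zeros same-block) s≢i s≢j
... | tri≈ _ refl _ = refl
... | tri> _ _ j<i =
  sym (adj-transpose b j<i (sameBlock⇒constantOnTops k b 2≤k zeros (swap-block same-block)) s≢j s≢i)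
  where
  swap-block : SameBlock k b i j → SameBlock k b j i
  swap-block (t , i∈t , j∈t) = t , j∈t , i∈t
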